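{- Let $m\ge 2$ be an integer and write $T(k)=\frac{k^2+k}{2}$. Suppose there exist integers $q$ and $d$ with $0\le q<m$, $d\ge 0$, $T(d)<m$, $T(q)\equiv T(d)\pmod m$, $q\neq d$ and $m-q-1\neq d$ (i.e. $q$ has a non-trivial triangular remainder regarding $m$). Then $m$ is composite.
   Context: $T(k)=\frac{k^2+k}{2}$ denotes the $k$-th triangular number. A number $q$ with $0\le q<m$ has a non-trivial triangular remainder regarding $m$ if $T(q)\equiv T(d)\pmod m$ for some non-negative integer $d$ with $T(d)<m$, $q\neq d$ and $m-q-1\neq d$. -}

module Defs where

open import Data.Nat using (ℕ; suc; _*_; _/_)

T : ℕ → ℕ
T k = (k * suc k) / 2

-- Since 2(T q − T d) = (q − d)(q + d + 1), a prime m dividing T q − T d must divide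
-- q − d or q + d + 1. For distinct q, d < m the first factor is a nonzero number
-- below m, and the second lies strictly between 0 and 2m, so q + d + 1 = m, which
-- is exactly the trivial remainder d = m − q − 1.
module Submission where

open import Defs
open import Data.Nat using (ℕ; zero; suc; _+_; _*_; _∸_; _/_; _%_; _<_; _≤_; z≤n; s≤s; NonZero)
open import Data.Nat.Base using (n>1⇒nonTrivial; >-nonZero)
open import Data.Nat.Properties
open import Data.Nat.DivMod using (m≡m%n+[m/n]*n; m*n/n≡m)
open import Data.Nat.Divisibility using (_∣_; divides; ∣⇒≤; ∣n⇒∣m*n)
open import Data.Nat.Primality using (Prime; Composite; euclidsLemma; ¬prime⇒composite)
open import Data.Nat.Solver using (module +-*-Solver)
open import Data.Sum using (inj₁; inj₂)
open import Data.Product using (_,_)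
open import Relation.Nullary using (contradiction)
open import Relation.Binary using (tri<; tri≈; tri>)
open import Relation.Binary.PropositionalEquality
  using (_≡_; _≢_; refl; sym; trans; cong; cong₂; subst; subst₂; module ≡-Reasoning)
open +-*-Solver
open ≡-Reasoning

triangle : ℕ → ℕ
triangle zero    = 0
triangle (suc k) = triangle k + suc k

2*triangle≡n*suc[n] : ∀ n → 2 * triangle n ≡ n * suc n
2*triangle≡n*suc[n] zero    = refl
2*triangle≡n*suc[n] (suc n) = begin
  2 * (triangle n + suc n)       ≡⟨ *-distribˡ-+ 2 (triangle n) (suc n) ⟩
  2 * triangle n + 2 * suc n     ≡⟨ cong (_+ 2 * suc n) (2*triangle≡n*suc[n] n) ⟩
  n * suc n + 2 * suc n          ≡⟨ step n ⟩
  suc n * suc (suc n)            ∎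
  where
  step : ∀ n → n * suc n + 2 * suc n ≡ suc n * suc (suc n)
  step = solve 1 (λ n → n :* (con 1 :+ n) :+ con 2 :* (con 1 :+ n)
                      := (con 1 :+ n) :* (con 2 :+ n)) refl

T≡triangle : ∀ n → T n ≡ triangle n
T≡triangle n = begin
  n * suc n / 2          ≡⟨ cong (_/ 2) (sym (2*triangle≡n*suc[n] n)) ⟩
  2 * triangle n / 2     ≡⟨ cong (_/ 2) (*-comm 2 (triangle n)) ⟩
  triangle n * 2 / 2     ≡⟨ m*n/n≡m (triangle n) 2 ⟩
  triangle n             ∎

n≤triangle : ∀ n → n ≤ triangle n
n≤triangle zero    = z≤n
n≤triangle (suc n) = m≤n+m (suc n) (triangle n)

2*[triangle∸triangle] : ∀ {d q} → d ≤ q →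
                        2 * (triangle q ∸ triangle d) ≡ (q ∸ d) * suc (q + d)
2*[triangle∸triangle] {d} d≤q with m≤n⇒∃[o]m+o≡n d≤q
... | e , refl = begin
  2 * (triangle (d + e) ∸ triangle d)             ≡⟨ *-distribˡ-∸ 2 (triangle (d + e)) (triangle d) ⟩
  2 * triangle (d + e) ∸ 2 * triangle d           ≡⟨ cong₂ _∸_ (2*triangle≡n*suc[n] (d + e)) (2*triangle≡n*suc[n] d) ⟩
  (d + e) * suc (d + e) ∸ d * suc d               ≡⟨ cong (_∸ d * suc d) (split d e) ⟩
  d * suc d + e * suc (d + e + d) ∸ d * suc d     ≡⟨ m+n∸m≡n (d * suc d) _ ⟩
  e * suc (d + e + d)                             ≡⟨ cong (_* suc (d + e + d)) (m+n∸m≡n d e) ⟨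
  (d + e ∸ d) * suc (d + e + d)                   ∎
  where
  split : ∀ d e → (d + e) * suc (d + e) ≡ d * suc d + e * suc (d + e + d)
  split = solve 2 (λ d e → (d :+ e) :* (con 1 :+ (d :+ e))
                        := d :* (con 1 :+ d) :+ e :* (con 1 :+ (d :+ e :+ d))) refl

m%n≡o%n⇒n∣m∸o : ∀ m o n .{{_ : NonZero n}} → m % n ≡ o % n → n ∣ m ∸ o
m%n≡o%n⇒n∣m∸o m o n eq = divides (m / n ∸ o / n) (begin
  m ∸ o                                      ≡⟨ cong₂ _∸_ (m≡m%n+[m/n]*n m n) (m≡m%n+[m/n]*n o n) ⟩
  (m % n + m / n * n) ∸ (o % n + o / n * n)  ≡⟨ cong (λ r → (m % n + m / n * n) ∸ (r + o / n * n)) eq ⟨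
  (m % n + m / n * n) ∸ (m % n + o / n * n)  ≡⟨ [m+n]∸[m+o]≡n∸o (m % n) _ _ ⟩
  m / n * n ∸ o / n * n                      ≡⟨ *-distribʳ-∸ n (m / n) (o / n) ⟨
  (m / n ∸ o / n) * n                        ∎)

prime∣m*n⇒∣n : ∀ {p} m n → Prime p → 0 < m → m < p → p ∣ m * n → p ∣ n
prime∣m*n⇒∣n m n prime-p 0<m m<p p∣m*n with euclidsLemma m n prime-p p∣m*n
... | inj₁ p∣m = contradiction (∣⇒≤ {{>-nonZero 0<m}} p∣m) (<⇒≱ m<p)
... | inj₂ p∣n = p∣n

m∣n∧0<n<m+m⇒n≡m : ∀ {m n} → m ∣ n → 0 < n → n < m + m → n ≡ m
m∣n∧0<n<m+m⇒n≡m (divides zero refl)          ()  _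
m∣n∧0<n<m+m⇒n≡m {m} (divides (suc zero) refl) _   _    = +-identityʳ m
m∣n∧0<n<m+m⇒n≡m {m} (divides (suc (suc k)) refl) _ n<2m =
  contradiction (+-monoʳ-≤ m (m≤m+n m (k * m))) (<⇒≱ n<2m)

triangle-collision : ∀ {p d q} .{{_ : NonZero p}} → Prime p → d < q → q < p →
                     triangle q % p ≡ triangle d % p → suc (q + d) ≡ p
triangle-collision {p} {d} {q} prime-p d<q q<p collide =
  m∣n∧0<n<m+m⇒n≡m p∣q+d+1 (s≤s z≤n) q+d+1<p+p
  where
  p∣2*difference : p ∣ (q ∸ d) * suc (q + d)
  p∣2*difference = subst (p ∣_) (2*[triangle∸triangle] (<⇒≤ d<q))
    (∣n⇒∣m*n 2 (m%n≡o%n⇒n∣m∸o (triangle q) (triangle d) p collide))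
  p∣q+d+1 : p ∣ suc (q + d)
  p∣q+d+1 = prime∣m*n⇒∣n (q ∸ d) _ prime-p (m<n⇒0<n∸m d<q)
              (≤-<-trans (m∸n≤m q d) q<p) p∣2*difference
  q+d+1<p+p : suc (q + d) < p + p
  q+d+1<p+p = subst (_≤ p + p) (cong suc (+-suc q d)) (+-mono-≤ q<p (<-trans d<q q<p))

suc[m+n]≡o⇒o∸m∸1≡n : ∀ {m n o} → suc (m + n) ≡ o → o ∸ m ∸ 1 ≡ n
suc[m+n]≡o⇒o∸m∸1≡n {m} {n} refl = cong (_∸ 1) (begin
  suc (m + n) ∸ m  ≡⟨ cong (_∸ m) (+-suc m n) ⟨
  m + suc n ∸ m    ≡⟨ m+n∸m≡n m (suc n) ⟩
  suc n            ∎)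

proposition10 : (m : ℕ) → 2 ≤ m → .{{_ : NonZero m}} →
                (q d : ℕ) → q < m → T d < m →
                T q % m ≡ T d % m → q ≢ d → m ∸ q ∸ 1 ≢ d →
                Composite m
proposition10 m 2≤m q d q<m Td<m Tq≡Td q≢d nontrivial =
  ¬prime⇒composite {{n>1⇒nonTrivial 2≤m}} λ prime-m →
    nontrivial (suc[m+n]≡o⇒o∸m∸1≡n (q+d+1≡m prime-m))
  where
  d<m : d < m
  d<m = ≤-<-trans (≤-trans (n≤triangle d) (≤-reflexive (sym (T≡triangle d)))) Td<m
  collide : triangle q % m ≡ triangle d % m
  collide = subst₂ (λ a b → a % m ≡ b % m) (T≡triangle q) (T≡triangle d) Tq≡Td
  q+d+1≡m : Prime m → suc (q + d) ≡ m
  q+d+1≡m prime-m with <-cmp q d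
  ... | tri< q<d _ _ = trans (cong suc (+-comm q d)) (triangle-collision prime-m q<d d<m (sym collide))
  ... | tri≈ _ q≡d _ = contradiction q≡d q≢d
  ... | tri> _ _ d<q = triangle-collision prime-m d<q q<m collide
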